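{- There is no SLCS formula $\varphi$ such that for every neighbourhood model $\mathcal{M}$, the underlying space of $\mathcal{M}$ is connected if and only if $\mathcal{M},x\models\varphi$ for every point $x$ of $\mathcal{M}$.
   Context: A neighbourhood space $(X,\mathcal{N})$ assigns to each $x\in X$ a filter $\mathcal{N}(x)$ on $X$ (non-empty-intersection-closed, upward closed, not containing $\emptyset$) with $x\in N$ for all $N\in\mathcal{N}(x)$. Closure: $\mathcal{C}(A)=\{x\mid\forall N\in\mathcal{N}(x): A\cap N\ne\emptyset\}$. Continuity of $f$: for all $x$ and $N_2\in\mathcal{N}_2(f(x))$, $f^{ -1}[N_2]\in\mathcal{N}_1(x)$. Sets $U,V$ are semi-separated if $\mathcal{C}(U)\cap V=U\cap\mathcal{C}(V)=\emptyset$; a set is connected if it is not the union of two non-empty semi-separated sets; the space is connected if $X$ is. An index space $(I,\mathcal{N}_I,\le,0)$ is a connected neighbourhood space with a linear order with least element $0$; a path is a continuous map from the index space into the space. A neighbourhood model is $((X,\mathcal{N}),\mathcal{I},V)$ with $\mathcal{I}$ an index space and $V:X\to\mathcal{P}(\mathsf{P})$ a valuation of atoms. SLCS formulas: $\varphi::=a\mid\top\mid\neg\varphi\mid\varphi\wedge\varphi\mid\mathcal{N}\varphi\mid\varphi\,\mathcal{R}\,\varphi\mid\varphi\,\mathcal{P}\,\varphi$, with semantics: $x\models a$ iff $a\in V(x)$; Booleans as usual; $x\models\mathcal{N}\varphi$ iff $x\in\mathcal{C}(\{y\mid y\models\varphi\})$; $x\models\varphi\,\mathcal{R}\,\psi$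 iff there are a path $p$ and $n$ with $p(n)=x$, $p(0)\models\psi$ and $p(i)\models\varphi$ for all $0<i\le n$; $x\models\varphi\,\mathcal{P}\,\psi$ iff there are a path $p$ with $p(0)=x$ and $n$ with $p(n)\models\psi$ and $p(i)\models\varphi$ for all $0\le i<n$. -}

module Defs where

open import Level using (Level; 0ℓ) renaming (suc to lsuc)
open import Data.Product using (Σ; ∃; _×_; _,_)
open import Data.Sum using (_⊎_)
open import Data.Empty using (⊥)
open import Data.Unit using (⊤)
open import Relation.Nullary using (¬_)
open import Relation.Binary.PropositionalEquality using (_≡_)
open import Relation.Binary.Structures using (IsTotalOrder)

Subset : Set → Set₁
Subset X = X → Set

_∩_ : {X : Set} → Subset X → Subset X → Subset X
(A ∩ B) x = A x × B x

_⊆_ : {X : Set} → Subset X → Subset X → Set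
A ⊆ B = ∀ x → A x → B x

record IsFilter {X : Set} (F : Subset X → Set) : Set₁ where
  field
    contains-X : F (λ _ → ⊤)
    ∩-closed   : ∀ A B → F A → F B → F (A ∩ B)
    up-closed  : ∀ A B → A ⊆ B → F A → F B
    no-empty   : ∀ A → F A → ¬ (∀ x → ¬ A x)

record NbhdSpace (X : Set) : Set₁ where
  field
    𝒩        : X → Subset X → Set
    isFilter : ∀ x → IsFilter (𝒩 x)
    point∈   : ∀ x N → 𝒩 x N → N x

  -- closure
  -- (level-polymorphic so it also applies to satisfaction sets)
  𝒞 : ∀ {ℓ} → (X → Set ℓ) → X → Set (lsuc 0ℓ Level.⊔ ℓ)
  𝒞 A x = ∀ N → 𝒩 x N → ∃ λ y → A y × N y

  SemiSeparated : Subset X → Subset X → Set₁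
  SemiSeparated U V = (∀ x → 𝒞 U x → V x → ⊥) × (∀ x → U x → 𝒞 V x → ⊥)

  ConnectedSet : Subset X → Set₁
  ConnectedSet A = ¬ (Σ (Subset X) λ U → Σ (Subset X) λ V →
      (∀ x → A x → U x ⊎ V x) × (∀ x → U x ⊎ V x → A x)
    × (∃ λ u → U u) × (∃ λ v → V v) × SemiSeparated U V)

  Connected : Set₁
  Connected = ConnectedSet (λ _ → ⊤)
  
open NbhdSpace

Continuous : {X Y : Set} → NbhdSpace X → NbhdSpace Y → (X → Y) → Set₁
Continuous S T f = ∀ x N₂ → 𝒩 T (f x) N₂ → 𝒩 S x (λ y → N₂ (f y))

record IndexSpace : Set₁ where
  field
    I          : Set
    space      : NbhdSpace I
    connected  : Connected space
    _≤_        : I → I → Set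
    isTotal    : IsTotalOrder _≡_ _≤_
    𝟘          : I
    𝟘-least    : ∀ i → 𝟘 ≤ i

  _<_ : I → I → Set
  i < j = (i ≤ j) × ¬ (i ≡ j)

record NbhdModel (P : Set) : Set₁ where
  field
    X     : Set
    space : NbhdSpace X
    index : IndexSpace
    V     : X → Subset P

  open IndexSpace index using (I; _≤_; _<_; 𝟘) renaming (space to Ispace)

  Path : Set₁
  Path = Σ (I → X) λ p → Continuous Ispace space p

data Formula (P : Set) : Set where
  atom : P → Formula P
  ⊤′   : Formula P
  ¬′_  : Formula P → Formula P
  _∧′_ : Formula P → Formula P → Formula P
  𝒩′_  : Formula P → Formula P
  _ℛ_  : Formula P → Formula P → Formula P
  _𝒫_  : Formula P → Formula P → Formula P

module _ {P : Set} (M : NbhdModel P) where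
  open NbhdModel M
  open IndexSpace index using (I; _≤_; _<_; 𝟘)

  _⊨_ : X → Formula P → Set₁
  x ⊨ atom a   = Level.Lift _ (V x a)
  x ⊨ ⊤′       = Level.Lift _ ⊤
  x ⊨ (¬′ φ)   = ¬ (x ⊨ φ)
  x ⊨ (φ ∧′ ψ) = (x ⊨ φ) × (x ⊨ ψ)
  x ⊨ (𝒩′ φ)   = 𝒞 space (λ y → y ⊨ φ) x
  x ⊨ (φ ℛ ψ)  = Σ Path λ { (p , _) → ∃ λ n →
      (p n ≡ x) × (p 𝟘 ⊨ ψ) × (∀ i → 𝟘 < i → i ≤ n → p i ⊨ φ) }
  x ⊨ (φ 𝒫 ψ)  = Σ Path λ { (p , _) → (p 𝟘 ≡ x) × ∃ λ n →
      (p n ⊨ ψ) × (∀ i → 𝟘 ≤ i → i < n → p i ⊨ φ) }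

module Submission where

-- The proof compares the family of "trivial" models 𝔻 X: the discrete
-- neighbourhood space on a type X, the one-point index space, and the
-- valuation making every atom false.  In such a model the closure of a
-- set is the set itself and every path is constant, so 𝒩 φ, φ ℛ ψ and
-- φ 𝒫 ψ collapse to φ, ψ and ψ; consequently whether a point satisfies φ
-- depends neither on the point nor on the carrier X (`transfer`).
-- On the other hand the discrete space on a subsingleton (⊤) is
-- connected, while the discrete space on Bool is not.  A formula
-- characterising connectedness would hold everywhere in 𝔻 ⊤, hence by
-- transfer everywhere in 𝔻 Bool, forcing Bool's discrete space to be
-- connected.

open import Defs
open import Data.Product using (Σ; _,_)
open import Relation.Nullary using (¬_)
open import Function.Bundles using (_⇔_; Equivalence)
open import Data.Unit using (⊤; tt)
open import Data.Bool using (Bool; true; false)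
open import Data.Sum using (_⊎_; inj₁; inj₂)
open import Data.Empty using (⊥; ⊥-elim)
open import Relation.Binary.PropositionalEquality
  using (_≡_; refl; sym; trans; subst; isEquivalence)
open import Relation.Binary.Structures using (IsTotalOrder)
open import Level using (lift)

open NbhdSpace

discrete : (X : Set) → NbhdSpace X
discrete X = record
  { 𝒩        = λ x N → N x
  ; isFilter = λ x → record
      { contains-X = tt
      ; ∩-closed   = λ _ _ a b → a , b
      ; up-closed  = λ _ _ A⊆B a → A⊆B x a
      ; no-empty   = λ _ a empty → empty x a }
  ; point∈   = λ _ _ n → n }

-- In a discrete space every set is closed: x ∈ 𝒞 A forces x ∈ A,
-- since {x} itself is a neighbourhood of x.
closure-discrete : ∀ {X ℓ} (A : X → Set ℓ) x → 𝒞 (discrete X) A x → A x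
closure-discrete A x x∈𝒞A with x∈𝒞A (x ≡_) refl
... | _ , a , refl = a

-- A discrete space on a type with at most one element is connected:
-- a point u ∈ U lies in the closure of any inhabited V, since u equals
-- every point of V.
subsingleton-connected : ∀ {X} → (∀ (a b : X) → a ≡ b) → Connected (discrete X)
subsingleton-connected all-equal (U , V , _ , _ , (u , u∈U) , (v , v∈V) , _ , sep) =
  sep u u∈U (λ N u∈N → v , v∈V , subst N (all-equal u v) u∈N)

-- A non-constant Boolean function on X splits the discrete space on X
-- into two disjoint non-empty closed pieces, so it is not connected.
nonconstant-disconnects : ∀ {X} (f : X → Bool) {x y : X} →
  f x ≡ true → f y ≡ false → ¬ Connected (discrete X)
nonconstant-disconnects {X} f {x} {y} fx fy connected =
  connected (U , V , cover , (λ _ _ → tt) , (x , fx) , (y , fy) , sep₁ , sep₂)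
  where
  U V : Subset X
  U z = f z ≡ true
  V z = f z ≡ false

  disjoint : ∀ z → U z → V z → ⊥
  disjoint z u v with trans (sym u) v
  ... | ()

  side : ∀ {z} b → f z ≡ b → U z ⊎ V z
  side true  fz = inj₁ fz
  side false fz = inj₂ fz

  cover : ∀ z → ⊤ → U z ⊎ V z
  cover z _ = side (f z) refl

  sep₁ : ∀ z → 𝒞 (discrete X) U z → V z → ⊥
  sep₁ z z∈𝒞U = disjoint z (closure-discrete U z z∈𝒞U)

  sep₂ : ∀ z → U z → 𝒞 (discrete X) V z → ⊥
  sep₂ z u z∈𝒞V = disjoint z u (closure-discrete V z z∈𝒞V)

-- Constant maps are continuous between arbitrary neighbourhood spaces:
-- the preimage of a neighbourhood of y under (λ _ → y) is the whole space.
constant-continuous : ∀ {X Y} (S : NbhdSpace X) (T : NbhdSpace Y) (y : Y) →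
  Continuous S T (λ _ → y)
constant-continuous S T y x N N∈𝒩y =
  IsFilter.up-closed (isFilter S x) (λ _ → ⊤) (λ _ → N y)
    (λ _ _ → point∈ T y N N∈𝒩y) (IsFilter.contains-X (isFilter S x))

point-order : IsTotalOrder {A = ⊤} _≡_ (λ _ _ → ⊤)
point-order = record
  { isPartialOrder = record
    { isPreorder = record
      { isEquivalence = isEquivalence
      ; reflexive     = λ _ → tt
      ; trans         = λ _ _ → tt }
    ; antisym = λ _ _ → refl }
  ; total = λ _ _ → inj₁ tt }

point-index : IndexSpace
point-index = record
  { I = ⊤ ; space = discrete ⊤ ; connected = subsingleton-connected (λ _ _ → refl)
  ; _≤_ = λ _ _ → ⊤ ; isTotal = point-order ; 𝟘 = tt ; 𝟘-least = λ _ → tt }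

-- The one-point index space has no strictly ordered pair of indices, so
-- the conditions ℛ and 𝒫 impose on intermediate path points are vacuous.
no-strict-pair : ∀ i j → ¬ IndexSpace._<_ point-index i j
no-strict-pair tt tt (_ , tt≢tt) = tt≢tt refl

𝔻 : (P : Set) → Set → NbhdModel P
𝔻 P X = record { X = X ; space = discrete X ; index = point-index ; V = λ _ _ → ⊥ }

constant-path : ∀ {X} P → X → NbhdModel.Path (𝔻 P X)
constant-path {X} _ y = (λ _ → y) , constant-continuous (discrete ⊤) (discrete X) y

-- Induction on φ, simultaneously in both directions (needed for ¬):
-- 𝒩 φ holds iff φ holds somewhere, and ℛ/𝒫 reduce to ψ via constant paths.
transfer : ∀ {P X Y} (φ : Formula P) (x : X) (y : Y) →
  _⊨_ (𝔻 P X) x φ → _⊨_ (𝔻 P Y) y φ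
transfer (atom a) x y (lift ())
transfer ⊤′ x y _ = lift tt
transfer (¬′ φ) x y x⊭φ y⊨φ = x⊭φ (transfer φ y x y⊨φ)
transfer (φ ∧′ ψ) x y (x⊨φ , x⊨ψ) = transfer φ x y x⊨φ , transfer ψ x y x⊨ψ
transfer (𝒩′ φ) x y x∈𝒞φ N y∈N with x∈𝒞φ (λ _ → ⊤) tt
... | z , z⊨φ , _ = y , transfer φ z y z⊨φ , y∈N
transfer {P} (φ ℛ ψ) x y ((p , _) , _ , _ , p𝟘⊨ψ , _) =
  constant-path P y , tt , refl , transfer ψ (p tt) y p𝟘⊨ψ ,
  λ i 𝟘<i _ → ⊥-elim (no-strict-pair tt i 𝟘<i)
transfer {P} (φ 𝒫 ψ) x y ((p , _) , _ , n , pn⊨ψ , _) =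
  constant-path P y , refl , tt , transfer ψ (p n) y pn⊨ψ ,
  λ i _ i<n → ⊥-elim (no-strict-pair i n i<n)

proposition21 : (P : Set) → ¬ (Σ (Formula P) λ φ →
    (M : NbhdModel P) →
    NbhdSpace.Connected (NbhdModel.space M) ⇔ (∀ x → _⊨_ M x φ))
proposition21 P (φ , characterises) =
  nonconstant-disconnects (λ b → b) {true} {false} refl refl bool-connected
  where
  ⊤⊨φ : _⊨_ (𝔻 P ⊤) tt φ
  ⊤⊨φ = Equivalence.to (characterises (𝔻 P ⊤))
          (subsingleton-connected (λ _ _ → refl)) tt

  bool-connected : Connected (discrete Bool)
  bool-connected = Equivalence.from (characterises (𝔻 P Bool))
                     (λ b → transfer φ tt b ⊤⊨φ)
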